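{- For every positive integer $r$, the symplectic graph $Sp(2r)$ is not $3$-e.c.
   Context: A graph $G$ with vertex set $V$ is $n$-e.c. ($n$-existentially complete) if for every pair of disjoint subsets $A,B\subseteq V$ with $|A\cup B|=n$ (either of $A$, $B$ may be empty) there is a vertex $z\notin A\cup B$ adjacent to every vertex of $A$ and to no vertex of $B$. Let $\mathbb{F}_2$ be the binary field and let $N$ be the $2r\times 2r$ block diagonal matrix over $\mathbb{F}_2$ with $r$ diagonal blocks equal to $\begin{pmatrix}0&1\\1&0\end{pmatrix}$. The symplectic graph $Sp(2r)$ has vertex set $\mathbb{F}_2^{2r}\setminus\{0\}$, with distinct vertices $x,y$ adjacent if and only if $x^T N y=1$. -}

module Defs where

open import Data.Nat using (ℕ; zero; suc; _+_; _*_)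
open import Data.Nat.DivMod using (_/_)
open import Data.Bool using (Bool; true; false; _xor_; _∧_)
open import Data.Fin using (Fin; toℕ)
import Data.Fin
open import Data.List using (List; length)
open import Data.List.Membership.Propositional using (_∈_; _∉_)
open import Data.List.Relation.Unary.Unique.Propositional using (Unique)
open import Data.Product using (Σ; ∃; _×_; _,_; proj₁)
open import Relation.Nullary using (¬_)
open import Relation.Binary.PropositionalEquality using (_≡_; _≢_)

record Graph (V : Set) : Set₁ where
  field
    Adj : V → V → Set

open Graph public

IsNEC : {V : Set} → ℕ → Graph V → Set
IsNEC {V} n G =
  (A B : List V) → Unique A → Unique B →
  (∀ {v} → v ∈ A → v ∉ B) →
  length A + length B ≡ n →
  Σ V λ z → z ∉ A × z ∉ B ×
    (∀ {a} → a ∈ A → Adj G z a) ×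
    (∀ {b} → b ∈ B → ¬ Adj G z b)

-- Vectors over F₂ = Bool (with xor as +, ∧ as ·).
F2Vec : ℕ → Set
F2Vec m = Fin m → Bool

zeroVec : (m : ℕ) → F2Vec m
zeroVec m _ = false

Σ₂ : (m : ℕ) → (Fin m → Bool) → Bool
Σ₂ zero f = false
Σ₂ (suc m) f = f Data.Fin.zero xor Σ₂ m (λ i → f (Data.Fin.suc i))

-- The 2r×2r block diagonal matrix N with r blocks [[0,1],[1,0]]:
-- N i j = 1 iff i and j are distinct indices lying in the same 2×2 block,
-- i.e. ⌊i/2⌋ = ⌊j/2⌋ and i ≠ j.
open import Data.Nat using (_≡ᵇ_)
open import Data.Bool using (not)

Nmat : (r : ℕ) → Fin (2 * r) → Fin (2 * r) → Bool
Nmat r i j = ((toℕ i / 2) ≡ᵇ (toℕ j / 2)) ∧ not (toℕ i ≡ᵇ toℕ j)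

form : (r : ℕ) → F2Vec (2 * r) → F2Vec (2 * r) → Bool
form r x y = Σ₂ (2 * r) λ i → Σ₂ (2 * r) λ j → x i ∧ (Nmat r i j ∧ y j)

SpVertex : ℕ → Set
SpVertex r = Σ (F2Vec (2 * r)) λ x → ¬ (∀ i → x i ≡ false)

Sp : (r : ℕ) → Graph (SpVertex r)
Sp r = record { Adj = λ x y → (x ≢ y) × (form r (proj₁ x) (proj₁ y) ≡ true) }

-- The symplectic form is linear in each argument, so a vertex z adjacent to
-- both x and y has ⟨z, x + y⟩ = 1 + 1 = 0 and is not adjacent to x + y.
-- For two coordinate vectors e, e′ the vertices e, e′, e + e′ are distinct, so
-- A = {e, e′, e + e′}, B = ∅ witnesses the failure of the 3-e.c. property.
module Submission where

open import Defs
open import Algebra using (CommutativeRing)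
open import Data.Bool using (Bool; true; false; _xor_; _∧_)
open import Data.Bool.Properties using (xor-∧-commutativeRing; ∧-distribˡ-xor)
open import Data.Fin using (Fin; _≟_)
import Data.Fin as Fin
open import Data.List using ([]; _∷_)
open import Data.List.Relation.Unary.All using ([]; _∷_)
open import Data.List.Relation.Unary.AllPairs using ([]; _∷_)
open import Data.List.Relation.Unary.Any using (here; there)
open import Data.Nat using (ℕ; zero; suc; _*_)
open import Data.Product using (Σ; _×_; _,_; proj₁)
open import Relation.Binary.PropositionalEquality
open import Relation.Nullary using (¬_; does)
open import Relation.Nullary.Decidable using (dec-true; dec-false)

open import Algebra.Properties.CommutativeSemigroup
  (CommutativeRing.+-commutativeSemigroup xor-∧-commutativeRing) using (interchange)

infixl 6 _⊕_

_⊕_ : ∀ {m} → F2Vec m → F2Vec m → F2Vec m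
(x ⊕ y) i = x i xor y i

Σ₂-cong : ∀ m {f g : Fin m → Bool} → (∀ i → f i ≡ g i) → Σ₂ m f ≡ Σ₂ m g
Σ₂-cong zero    f≗g = refl
Σ₂-cong (suc m) f≗g = cong₂ _xor_ (f≗g Fin.zero) (Σ₂-cong m (λ i → f≗g (Fin.suc i)))

Σ₂-distrib-xor : ∀ m (f g : Fin m → Bool) → Σ₂ m (f ⊕ g) ≡ Σ₂ m f xor Σ₂ m g
Σ₂-distrib-xor zero    f g = refl
Σ₂-distrib-xor (suc m) f g = begin
  (f₀ xor g₀) xor Σ₂ m (f′ ⊕ g′)          ≡⟨ cong ((f₀ xor g₀) xor_) (Σ₂-distrib-xor m f′ g′) ⟩
  (f₀ xor g₀) xor (Σ₂ m f′ xor Σ₂ m g′)   ≡⟨ interchange f₀ g₀ (Σ₂ m f′) (Σ₂ m g′) ⟩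
  (f₀ xor Σ₂ m f′) xor (g₀ xor Σ₂ m g′)   ∎
  where
  open ≡-Reasoning
  f₀ = f Fin.zero
  g₀ = g Fin.zero
  f′ = λ i → f (Fin.suc i)
  g′ = λ i → g (Fin.suc i)

form-linearʳ : ∀ r z x y → form r z (x ⊕ y) ≡ form r z x xor form r z y
form-linearʳ r z x y = begin
  form r z (x ⊕ y)
    ≡⟨ Σ₂-cong (2 * r) (λ i → Σ₂-cong (2 * r) λ j →
         trans (cong (z i ∧_) (∧-distribˡ-xor (Nmat r i j) (x j) (y j)))
               (∧-distribˡ-xor (z i) _ _)) ⟩
  Σ₂ (2 * r) (λ i → Σ₂ (2 * r) (term x i ⊕ term y i))
    ≡⟨ Σ₂-cong (2 * r) (λ i → Σ₂-distrib-xor (2 * r) (term x i) (term y i)) ⟩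
  Σ₂ (2 * r) ((λ i → Σ₂ (2 * r) (term x i)) ⊕ (λ i → Σ₂ (2 * r) (term y i)))
    ≡⟨ Σ₂-distrib-xor (2 * r) _ _ ⟩
  form r z x xor form r z y ∎
  where
  open ≡-Reasoning
  term : F2Vec (2 * r) → Fin (2 * r) → Fin (2 * r) → Bool
  term v i j = z i ∧ (Nmat r i j ∧ v j)

≡true-≢-≡false : ∀ {a b : Bool} → a ≡ true → b ≡ false → a ≢ b
≡true-≢-≡false refl refl ()

Sp-no-common-neighbour-of-sum :
  ∀ r {x y s z : SpVertex r} → proj₁ s ≡ proj₁ x ⊕ proj₁ y →
  Adj (Sp r) z x → Adj (Sp r) z y → ¬ Adj (Sp r) z s
Sp-no-common-neighbour-of-sum r {x} {y} {s} {z} refl (_ , zx) (_ , zy) (_ , zs) =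
  ≡true-≢-≡false zs (trans (form-linearʳ r (proj₁ z) (proj₁ x) (proj₁ y)) (cong₂ _xor_ zx zy)) refl

IsNEC-3⇒common-neighbour :
  ∀ {V} {G : Graph V} → IsNEC 3 G →
  ∀ {u v w} → u ≢ v → u ≢ w → v ≢ w →
  Σ V λ z → Adj G z u × Adj G z v × Adj G z w
IsNEC-3⇒common-neighbour nec u≢v u≢w v≢w
  with nec (_ ∷ _ ∷ _ ∷ []) [] ((u≢v ∷ u≢w ∷ []) ∷ (v≢w ∷ []) ∷ [] ∷ []) [] (λ _ ()) refl
... | z , _ , _ , adj , _ = z , adj (here refl) , adj (there (here refl)) , adj (there (there (here refl)))

unit : ∀ {m} → Fin m → F2Vec m
unit i j = does (i ≟ j)

unit-diag : ∀ {m} (i : Fin m) → unit i i ≡ true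
unit-diag i = dec-true (i ≟ i) refl

unit-off : ∀ {m} {i j : Fin m} → i ≢ j → unit i j ≡ false
unit-off {i = i} {j} i≢j = dec-false (i ≟ j) i≢j

nonzero-at : ∀ {m} {x : F2Vec m} i → x i ≡ true → ¬ (∀ j → x j ≡ false)
nonzero-at i xᵢ≡true x≡0 with () ← trans (sym xᵢ≡true) (x≡0 i)

vertex-≢ : ∀ {r} {u v : SpVertex r} i → proj₁ u i ≢ proj₁ v i → u ≢ v
vertex-≢ i uᵢ≢vᵢ refl = uᵢ≢vᵢ refl

module UnitTriangle {r} {i j : Fin (2 * r)} (i≢j : i ≢ j) where

  j≢i : j ≢ i
  j≢i = ≢-sym i≢j

  unitᵢ⊕unitⱼ-at-i : (unit i ⊕ unit j) i ≡ true
  unitᵢ⊕unitⱼ-at-i rewrite unit-diag i | unit-off j≢i = refl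

  unitᵢ⊕unitⱼ-at-j : (unit i ⊕ unit j) j ≡ true
  unitᵢ⊕unitⱼ-at-j rewrite unit-diag j | unit-off i≢j = refl

  eᵢ eⱼ eᵢ⊕eⱼ : SpVertex r
  eᵢ    = unit i , nonzero-at i (unit-diag i)
  eⱼ    = unit j , nonzero-at j (unit-diag j)
  eᵢ⊕eⱼ = unit i ⊕ unit j , nonzero-at i unitᵢ⊕unitⱼ-at-i

  eᵢ≢eⱼ : eᵢ ≢ eⱼ
  eᵢ≢eⱼ = vertex-≢ {r} i (≡true-≢-≡false (unit-diag i) (unit-off j≢i))

  eᵢ≢eᵢ⊕eⱼ : eᵢ ≢ eᵢ⊕eⱼ
  eᵢ≢eᵢ⊕eⱼ = vertex-≢ {r} j (≢-sym (≡true-≢-≡false unitᵢ⊕unitⱼ-at-j (unit-off i≢j)))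

  eⱼ≢eᵢ⊕eⱼ : eⱼ ≢ eᵢ⊕eⱼ
  eⱼ≢eᵢ⊕eⱼ = vertex-≢ {r} i (≢-sym (≡true-≢-≡false unitᵢ⊕unitⱼ-at-i (unit-off j≢i)))

mainTheorem1 : (r : ℕ) → ¬ IsNEC 3 (Sp (suc r))
mainTheorem1 r nec =
  let z , z~eᵢ , z~eⱼ , z~eᵢ⊕eⱼ = IsNEC-3⇒common-neighbour nec eᵢ≢eⱼ eᵢ≢eᵢ⊕eⱼ eⱼ≢eᵢ⊕eⱼ
  in Sp-no-common-neighbour-of-sum (suc r) refl z~eᵢ z~eⱼ z~eᵢ⊕eⱼ
  where
  -- 2 * suc r only reduces to suc (r + suc (r + 0)), so a second index is built with ↑ʳ.
  open UnitTriangle {suc r} {Fin.zero} {Fin.suc (r Fin.↑ʳ Fin.zero)} (λ ())
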